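{- Let $z\ge 0$ and $r\ge 1$ be integers with $(z,r)\notin\{(0,1),(0,2)\}$. Put \[ v=(z+r)^2+2(z-r)+1,\quad u_1=\frac{z+r-1-\sqrt{v}}{2},\quad u_2=\frac{z+r-1+\sqrt{v}}{2},\] \[ A=\frac{\sqrt{v}-(z+r+1)}{2\sqrt{v}},\quad B=\frac{\sqrt{v}+(z+r+1)}{2\sqrt{v}},\] and for $k\ge1$ let \[ M_{z,r,k}=A\frac{u_1^{k+1}-1}{u_1-1}+B\frac{u_2^{k+1}-1}{u_2-1}.\] Then there exists $K$ such that for all $k\ge K$, $M_{z,r,k}$ is the nearest integer to \[ B\frac{u_2^{k+1}-1}{u_2-1}-\frac{A}{u_1-1}.\]
   Context: Here $M_{z,r,k}$ is an integer: it equals $\sum_{j=0}^k L_j$, where $L_0=1$, $L_1=z+r$ and $L_j=(z+r-1)L_{j-1}+zL_{j-2}$ for $j\ge2$. -}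

module Defs where

open import Data.Nat as ℕ using (ℕ; zero; suc)
open import Data.Integer as ℤ using (ℤ)
open import Data.Rational as ℚ using (ℚ; 0ℚ; 1ℚ; ½; _≟_)
open import Data.Product using (_×_)
open import Data.Sum using (_⊎_)
open import Relation.Binary.PropositionalEquality using (_≡_)
open import Relation.Nullary using (¬_; yes; no)

-- The integer sequence of the context:
-- L_0 = 1, L_1 = z+r, L_j = (z+r-1) L_{j-1} + z L_{j-2};  M_{z,r,k} = Σ_{j=0}^k L_j.
-- (Used for r ≥ 1, so z + r ∸ 1 is the true z+r-1.)

L : ℕ → ℕ → ℕ → ℕ
L z r zero = 1
L z r (suc zero) = z ℕ.+ r
L z r (suc (suc j)) = (z ℕ.+ r ℕ.∸ 1) ℕ.* L z r (suc j) ℕ.+ z ℕ.* L z r j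

Msum : ℕ → ℕ → ℕ → ℕ
Msum z r zero = L z r zero
Msum z r (suc k) = Msum z r k ℕ.+ L z r (suc k)

-- Real numbers of the form a + b·√v  (a, b ∈ ℚ, v ∈ ℚ, v > 0), represented
-- as pairs.  All order/equality notions below refer to the REAL value
-- a + b·√v (√v the nonnegative square root), decided by rational arithmetic.

infix 0 _+√_

record Q√ : Set where
  constructor _+√_
  field
    re im : ℚ
open Q√ public

ofℚ : ℚ → Q√
ofℚ a = a +√ 0ℚ

ofℤ : ℤ → Q√
ofℤ n = ofℚ (n ℚ./ 1)

ofℕ : ℕ → Q√
ofℕ n = ofℤ (ℤ.+ n)

rt : Q√
rt = 0ℚ +√ 1ℚ

_⊕_ : Q√ → Q√ → Q√
(a +√ b) ⊕ (c +√ d) = (a ℚ.+ c) +√ (b ℚ.+ d)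

⊝_ : Q√ → Q√
⊝ (a +√ b) = ℚ.- a +√ ℚ.- b

_⊖_ : Q√ → Q√ → Q√
x ⊖ y = x ⊕ (⊝ y)

mul : ℚ → Q√ → Q√ → Q√
mul v (a +√ b) (c +√ d) = (a ℚ.* c ℚ.+ v ℚ.* (b ℚ.* d)) +√ (a ℚ.* d ℚ.+ b ℚ.* c)

-- total reciprocal on ℚ (1/0 := 0; only ever applied to nonzero arguments)
recip : ℚ → ℚ
recip q with q ≟ 0ℚ
... | yes _ = 0ℚ
... | no q≢0 = ℚ.1/_ q {{ℚ.≢-nonZero q≢0}}

-- reciprocal in ℚ(√v): 1/(a + b√v) = (a - b√v)/(a² - b² v)
-- (the correct real reciprocal whenever a² - b² v ≠ 0)
inv : ℚ → Q√ → Q√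
inv v (a +√ b) = (a ℚ.* n) +√ (ℚ.- b ℚ.* n)
  where n = recip (a ℚ.* a ℚ.- b ℚ.* b ℚ.* v)

div : ℚ → Q√ → Q√ → Q√
div v x y = mul v x (inv v y)

pow : ℚ → Q√ → ℕ → Q√
pow v x zero = ofℚ 1ℚ
pow v x (suc n) = mul v (pow v x n) x

-- a + b√v > 0  (for v > 0)
Pos : ℚ → Q√ → Set
Pos v (a +√ b) =
    (0ℚ ℚ.≤ a × 0ℚ ℚ.≤ b × ¬ (a ≡ 0ℚ × b ≡ 0ℚ))
  ⊎ (0ℚ ℚ.< a × b ℚ.< 0ℚ × b ℚ.* b ℚ.* v ℚ.< a ℚ.* a)
  ⊎ (a ℚ.< 0ℚ × 0ℚ ℚ.< b × a ℚ.* a ℚ.< b ℚ.* b ℚ.* v)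

-- a + b√v = 0  as a real number (for v > 0)
IsZero : ℚ → Q√ → Set
IsZero v (a +√ b) = a ℚ.* a ≡ b ℚ.* b ℚ.* v × a ℚ.* b ℚ.≤ 0ℚ

Same : ℚ → Q√ → Q√ → Set
Same v x y = IsZero v (x ⊖ y)

WithinHalf : ℚ → Q√ → Q√ → Set
WithinHalf v x y = Pos v (ofℚ ½ ⊖ (x ⊖ y)) × Pos v (ofℚ ½ ⊕ (x ⊖ y))

vv : ℕ → ℕ → ℚ
vv z r = ((z ℕ.+ r) ℕ.* (z ℕ.+ r) ℕ.+ 2 ℕ.* z ℕ.+ 1 ℤ.⊖ 2 ℕ.* r) ℚ./ 1

zr- zr+ : ℕ → ℕ → Q√
zr- z r = ofℤ ((z ℕ.+ r) ℤ.⊖ 1)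
zr+ z r = ofℕ (z ℕ.+ r ℕ.+ 1)

u₁ u₂ A B : ℕ → ℕ → Q√
u₁ z r = mul (vv z r) (ofℚ ½) (zr- z r ⊖ rt)
u₂ z r = mul (vv z r) (ofℚ ½) (zr- z r ⊕ rt)
A z r = div (vv z r) (rt ⊖ zr+ z r) (mul (vv z r) (ofℕ 2) rt)
B z r = div (vv z r) (rt ⊕ zr+ z r) (mul (vv z r) (ofℕ 2) rt)

geom : ℚ → Q√ → ℕ → Q√
geom v u k = div v (pow v u (suc k) ⊖ ofℚ 1ℚ) (u ⊖ ofℚ 1ℚ)

Mclosed : ℕ → ℕ → ℕ → Q√
Mclosed z r k = mul v (A z r) (geom v (u₁ z r) k) ⊕ mul v (B z r) (geom v (u₂ z r) k)
  where v = vv z r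

Xapprox : ℕ → ℕ → ℕ → Q√
Xapprox z r k = mul v (B z r) (geom v (u₂ z r) k) ⊖ div v (A z r) (u₁ z r ⊖ ofℚ 1ℚ)
  where v = vv z r

module Submission where

-- Write S = z+r-1, Z = z and v = S² + 4Z (= (z+r)² + 2(z-r) + 1), so that u₁,₂ = (S ∓ √v)/2
-- are the roots of X² = SX + Z.  All computations take place in ℚ(√v), represented by pairs
-- a + b√v; it is a commutative ring, and the real-number claims of the statement about such
-- pairs reduce to rational inequalities.
--  * Exactness.  By Binet's formula Tₘ = A u₁ᵐ + B u₂ᵐ satisfies the recurrence of L with
--    the same initial values, so Tₘ = Lₘ; summing the geometric series gives M_{z,r,k} = Σ Lⱼ.
--  * Approximation.  X_k - M_k = -c u₁^{k+1} with c = A/(u₁-1).  Scaling by Λ = vD, D = S+Z-1,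
--    turns c u₁ᵐ into qₘ = q₀u₁ᵐ with q₀ = v - (1+Z)√v, whose norm is Λ·R(-Z)ᵐ, R = S+1-Z = r.
--    The √v-part of qₘ stays negative and its rational part exceeds the norm bound R Zᵐ by at
--    least m (linear growth along the recurrence); a general norm criterion turns this into
--    |c u₁ᵐ| < ½ as soon as m > Λ.

open import Defs
open import Data.Nat as ℕ using (ℕ; zero; suc; _≤_)
import Data.Nat.Properties as ℕP
open import Data.Integer as ℤ using (ℤ; +_)
import Data.Integer.Properties as ℤP
open import Data.Integer.Solver using () renaming (module +-*-Solver to ℤ-Solver)
open import Data.Rational as ℚ using (ℚ; 0ℚ; 1ℚ; ½)
import Data.Rational.Properties as ℚP
open import Data.Rational.Unnormalised using (mkℚᵘ; *≡*)
import Data.Rational.Unnormalised.Properties as ℚᵘP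
open import Data.Rational.Solver using () renaming (module +-*-Solver to ℚ-Solver)
open import Data.Product using (_×_; _,_; proj₁; proj₂; ∃)
open import Data.Sum using (_⊎_; inj₁; inj₂)
open import Data.Maybe using (Maybe; just; nothing)
open import Level using (0ℓ)
open import Algebra.Bundles using (CommutativeRing)
open import Algebra.Structures using (IsCommutativeRing)
import Algebra.Solver.Ring.AlmostCommutativeRing as ACR
import Algebra.Solver.Ring as RingSolver
open import Relation.Binary.PropositionalEquality
open import Relation.Nullary using (¬_; yes; no)
open import Relation.Nullary.Negation using (contradiction)

ι : ℤ → ℚ
ι i = i ℚ./ 1

ι-+ : ∀ i j → ι (i ℤ.+ j) ≡ ι i ℚ.+ ι j
ι-+ i j = ℚP.toℚᵘ-injective (ℚᵘP.≃-trans (ℚP.toℚᵘ-fromℚᵘ (mkℚᵘ (i ℤ.+ j) 0))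
  (ℚᵘP.≃-trans (*≡* scaled) (ℚᵘP.≃-sym (ℚᵘP.≃-trans (ℚP.toℚᵘ-homo-+ (ι i) (ι j))
    (ℚᵘP.+-cong (ℚP.toℚᵘ-fromℚᵘ (mkℚᵘ i 0)) (ℚP.toℚᵘ-fromℚᵘ (mkℚᵘ j 0)))))))
  where
  open ℤ-Solver
  scaled : (i ℤ.+ j) ℤ.* + 1 ≡ (i ℤ.* + 1 ℤ.+ j ℤ.* + 1) ℤ.* + 1
  scaled = solve 2 (λ i j → (i :+ j) :* con (+ 1) := (i :* con (+ 1) :+ j :* con (+ 1)) :* con (+ 1)) refl i j

cN : ℕ → ℚ
cN n = ι (+ n)

cN-+ : ∀ m n → cN (m ℕ.+ n) ≡ cN m ℚ.+ cN n
cN-+ m n = ι-+ (+ m) (+ n)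

cN-* : ∀ m n → cN (m ℕ.* n) ≡ cN m ℚ.* cN n
cN-* zero n = sym (ℚP.*-zeroˡ (cN n))
cN-* (suc m) n = begin
  cN (n ℕ.+ m ℕ.* n)          ≡⟨ trans (cN-+ n (m ℕ.* n)) (cong (cN n ℚ.+_) (cN-* m n)) ⟩
  cN n ℚ.+ cN m ℚ.* cN n      ≡⟨ solve 2 (λ a b → b :+ a :* b := (con 1ℚ :+ a) :* b) refl (cN m) (cN n) ⟩
  (1ℚ ℚ.+ cN m) ℚ.* cN n      ≡⟨ cong (ℚ._* cN n) (sym (cN-+ 1 m)) ⟩
  cN (suc m) ℚ.* cN n         ∎
  where open ≡-Reasoning
        open ℚ-Solver

ι-⊖ : ∀ m n → ι (m ℤ.⊖ n) ≡ cN m ℚ.- cN n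
ι-⊖ m n = begin
  ι (m ℤ.⊖ n)              ≡⟨ cong ι (sym (ℤP.m-n≡m⊖n m n)) ⟩
  ι (+ m ℤ.+ ℤ.- (+ n))    ≡⟨ ι-+ (+ m) (ℤ.- (+ n)) ⟩
  cN m ℚ.+ ι (ℤ.- (+ n))   ≡⟨ cong (cN m ℚ.+_) (ι-neg n) ⟩
  cN m ℚ.- cN n            ∎
  where
  open ≡-Reasoning
  ι-neg : ∀ n → ι (ℤ.- (+ n)) ≡ ℚ.- cN n
  ι-neg zero = refl
  ι-neg (suc n) = refl

cN-nonneg : ∀ n → 0ℚ ℚ.≤ cN n
cN-nonneg n = ℚP.nonNegative⁻¹ _ {{ℚP.normalize-nonNeg n 1}}

cN-mono : ∀ {m n} → m ℕ.≤ n → cN m ℚ.≤ cN n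
cN-mono {m} {n} m≤n = begin
  cN m                     ≡⟨ sym (ℚP.+-identityʳ (cN m)) ⟩
  cN m ℚ.+ 0ℚ              ≤⟨ ℚP.+-monoʳ-≤ (cN m) (cN-nonneg (n ℕ.∸ m)) ⟩
  cN m ℚ.+ cN (n ℕ.∸ m)    ≡⟨ sym (cN-+ m (n ℕ.∸ m)) ⟩
  cN (m ℕ.+ (n ℕ.∸ m))     ≡⟨ cong cN (ℕP.m+[n∸m]≡n m≤n) ⟩
  cN n                     ∎
  where open ℚP.≤-Reasoning

nonneg-≡ : ∀ {x y} → 0ℚ ℚ.≤ x → x ≡ y → 0ℚ ℚ.≤ y
nonneg-≡ p refl = p

pos-≡ : ∀ {x y} → 0ℚ ℚ.< x → x ≡ y → 0ℚ ℚ.< y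
pos-≡ p refl = p

nonneg-+ : ∀ {a b} → 0ℚ ℚ.≤ a → 0ℚ ℚ.≤ b → 0ℚ ℚ.≤ a ℚ.+ b
nonneg-+ = ℚP.+-mono-≤

pos-+ : ∀ {a b} → 0ℚ ℚ.< a → 0ℚ ℚ.≤ b → 0ℚ ℚ.< a ℚ.+ b
pos-+ = ℚP.+-mono-<-≤

nonneg-* : ∀ {a b} → 0ℚ ℚ.≤ a → 0ℚ ℚ.≤ b → 0ℚ ℚ.≤ a ℚ.* b
nonneg-* {a} {b} p q = ℚP.nonNegative⁻¹ _
  {{ℚP.nonNeg*nonNeg⇒nonNeg a {{ℚ.nonNegative p}} b {{ℚ.nonNegative q}}}}

pos-* : ∀ {a b} → 0ℚ ℚ.< a → 0ℚ ℚ.< b → 0ℚ ℚ.< a ℚ.* b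
pos-* {a} {b} p q = ℚP.positive⁻¹ _ {{ℚP.pos*pos⇒pos a {{ℚ.positive p}} b {{ℚ.positive q}}}}

pos-cancelˡ : ∀ {c x} → 0ℚ ℚ.< c → 0ℚ ℚ.< c ℚ.* x → 0ℚ ℚ.< x
pos-cancelˡ {c} {x} c>0 cx>0 =
  ℚP.*-cancelˡ-<-nonNeg c {{ℚ.nonNegative (ℚP.<⇒≤ c>0)}} (subst (ℚ._< c ℚ.* x) (sym (ℚP.*-zeroʳ c)) cx>0)

≤⇒nonneg-diff : ∀ {a b} → a ℚ.≤ b → 0ℚ ℚ.≤ b ℚ.- a
≤⇒nonneg-diff {a} {b} a≤b = subst (ℚ._≤ b ℚ.- a) (ℚP.+-inverseʳ a) (ℚP.+-monoˡ-≤ (ℚ.- a) a≤b)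

<⇒pos-diff : ∀ {a b} → a ℚ.< b → 0ℚ ℚ.< b ℚ.- a
<⇒pos-diff {a} {b} a<b = subst (ℚ._< b ℚ.- a) (ℚP.+-inverseʳ a) (ℚP.+-monoˡ-< (ℚ.- a) a<b)

nonneg-diff⇒≤ : ∀ {a b} → 0ℚ ℚ.≤ b ℚ.- a → a ℚ.≤ b
nonneg-diff⇒≤ {a} {b} h = subst₂ ℚ._≤_ (ℚP.+-identityʳ a)
  (ℚ-Solver.solve 2 (λ a b → a :+ (b :- a) := b) refl a b) (ℚP.+-monoʳ-≤ a h)
  where open ℚ-Solver

pos-diff⇒< : ∀ {a b} → 0ℚ ℚ.< b ℚ.- a → a ℚ.< b
pos-diff⇒< {a} {b} h = subst₂ ℚ._<_ (ℚP.+-identityʳ a)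
  (ℚ-Solver.solve 2 (λ a b → a :+ (b :- a) := b) refl a b) (ℚP.+-monoʳ-< a h)
  where open ℚ-Solver

_^_ : ℚ → ℕ → ℚ
x ^ zero = 1ℚ
x ^ suc m = x ^ m ℚ.* x

^-nonneg : ∀ {x} → 0ℚ ℚ.≤ x → ∀ m → 0ℚ ℚ.≤ x ^ m
^-nonneg x≥0 zero = ℚP.nonNegative⁻¹ 1ℚ
^-nonneg x≥0 (suc m) = nonneg-* (^-nonneg x≥0 m) x≥0

neg-^ : ∀ x m → (ℚ.- x) ^ m ≡ x ^ m ⊎ (ℚ.- x) ^ m ≡ ℚ.- (x ^ m)
neg-^ x zero = inj₁ refl
neg-^ x (suc m) with neg-^ x m
... | inj₁ e = inj₂ (trans (cong (ℚ._* ℚ.- x) e) (sym (ℚP.neg-distribʳ-* (x ^ m) x)))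
... | inj₂ e = inj₁ (trans (cong (ℚ._* ℚ.- x) e)
                 (ℚ-Solver.solve 2 (λ p x → :- p :* :- x := p :* x) refl (x ^ m) x))
  where open ℚ-Solver

recip-inverse : ∀ q → q ≢ 0ℚ → q ℚ.* recip q ≡ 1ℚ
recip-inverse q q≢0 with q ℚ.≟ 0ℚ
... | yes q≡0 = contradiction q≡0 q≢0
... | no q≢0′ = ℚP.*-inverseʳ q {{ℚ.≢-nonZero q≢0′}}

module SqrtExt (v : ℚ) where

  infixl 30 _⊗_
  _⊗_ : Q√ → Q√ → Q√
  _⊗_ = mul v

  0√ 1√ : Q√
  0√ = ofℚ 0ℚ
  1√ = ofℚ 1ℚ

  ⊗-assoc : ∀ x y w → (x ⊗ y) ⊗ w ≡ x ⊗ (y ⊗ w)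
  ⊗-assoc (a +√ b) (c +√ d) (e +√ f) = cong₂ _+√_
    (solve 7 (λ a b c d e f v → (a :* c :+ v :* (b :* d)) :* e :+ v :* ((a :* d :+ b :* c) :* f)
       := a :* (c :* e :+ v :* (d :* f)) :+ v :* (b :* (c :* f :+ d :* e))) refl a b c d e f v)
    (solve 7 (λ a b c d e f v → (a :* c :+ v :* (b :* d)) :* f :+ (a :* d :+ b :* c) :* e
       := a :* (c :* f :+ d :* e) :+ b :* (c :* e :+ v :* (d :* f))) refl a b c d e f v)
    where open ℚ-Solver

  ⊗-comm : ∀ x y → x ⊗ y ≡ y ⊗ x
  ⊗-comm (a +√ b) (c +√ d) = cong₂ _+√_
    (solve 5 (λ a b c d v → a :* c :+ v :* (b :* d) := c :* a :+ v :* (d :* b)) refl a b c d v)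
    (solve 4 (λ a b c d → a :* d :+ b :* c := c :* b :+ d :* a) refl a b c d)
    where open ℚ-Solver

  ⊗-identityˡ : ∀ x → 1√ ⊗ x ≡ x
  ⊗-identityˡ (a +√ b) = cong₂ _+√_
    (solve 3 (λ a b v → con 1ℚ :* a :+ v :* (con 0ℚ :* b) := a) refl a b v)
    (solve 2 (λ a b → con 1ℚ :* b :+ con 0ℚ :* a := b) refl a b)
    where open ℚ-Solver

  ⊗-identityʳ : ∀ x → x ⊗ 1√ ≡ x
  ⊗-identityʳ x = trans (⊗-comm x 1√) (⊗-identityˡ x)

  ⊗-distribˡ : ∀ x y w → x ⊗ (y ⊕ w) ≡ x ⊗ y ⊕ x ⊗ w
  ⊗-distribˡ (a +√ b) (c +√ d) (e +√ f) = cong₂ _+√_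
    (solve 7 (λ a b c d e f v → a :* (c :+ e) :+ v :* (b :* (d :+ f))
       := (a :* c :+ v :* (b :* d)) :+ (a :* e :+ v :* (b :* f))) refl a b c d e f v)
    (solve 6 (λ a b c d e f → a :* (d :+ f) :+ b :* (c :+ e)
       := (a :* d :+ b :* c) :+ (a :* f :+ b :* e)) refl a b c d e f)
    where open ℚ-Solver

  ⊗-distribʳ : ∀ x y w → (y ⊕ w) ⊗ x ≡ y ⊗ x ⊕ w ⊗ x
  ⊗-distribʳ x y w = trans (⊗-comm (y ⊕ w) x)
    (trans (⊗-distribˡ x y w) (cong₂ _⊕_ (⊗-comm x y) (⊗-comm x w)))

  isCommutativeRing : IsCommutativeRing _≡_ _⊕_ _⊗_ ⊝_ 0√ 1√
  isCommutativeRing = record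
    { isRing = record
      { +-isAbelianGroup = record
        { isGroup = record
          { isMonoid = record
            { isSemigroup = record
              { isMagma = record { isEquivalence = isEquivalence ; ∙-cong = cong₂ _⊕_ }
              ; assoc = λ { (a +√ b) (c +√ d) (e +√ f) →
                  cong₂ _+√_ (ℚP.+-assoc a c e) (ℚP.+-assoc b d f) } }
            ; identity = (λ { (a +√ b) → cong₂ _+√_ (ℚP.+-identityˡ a) (ℚP.+-identityˡ b) })
                       , (λ { (a +√ b) → cong₂ _+√_ (ℚP.+-identityʳ a) (ℚP.+-identityʳ b) }) }
          ; inverse = (λ { (a +√ b) → cong₂ _+√_ (ℚP.+-inverseˡ a) (ℚP.+-inverseˡ b) })
                    , (λ { (a +√ b) → cong₂ _+√_ (ℚP.+-inverseʳ a) (ℚP.+-inverseʳ b) })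
          ; ⁻¹-cong = cong ⊝_ }
        ; comm = λ { (a +√ b) (c +√ d) → cong₂ _+√_ (ℚP.+-comm a c) (ℚP.+-comm b d) } }
      ; *-cong = cong₂ _⊗_
      ; *-assoc = ⊗-assoc
      ; *-identity = ⊗-identityˡ , ⊗-identityʳ
      ; distrib = ⊗-distribˡ , ⊗-distribʳ }
    ; *-comm = ⊗-comm }

  commutativeRing : CommutativeRing 0ℓ 0ℓ
  commutativeRing = record { isCommutativeRing = isCommutativeRing }

  ofℚ-morphism : ℚ.+-*-rawRing ACR.-Raw-AlmostCommutative⟶ ACR.fromCommutativeRing commutativeRing
  ofℚ-morphism = record
    { ⟦_⟧ = ofℚ
    ; +-homo = λ a b → refl
    ; *-homo = λ a b → cong₂ _+√_
        (solve 3 (λ a b v → a :* b := a :* b :+ v :* (con 0ℚ :* con 0ℚ)) refl a b v)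
        (solve 2 (λ a b → con 0ℚ := a :* con 0ℚ :+ con 0ℚ :* b) refl a b)
    ; -‿homo = λ a → refl
    ; 0-homo = refl
    ; 1-homo = refl }
    where open ℚ-Solver

  ofℚ-≟ : (a b : ℚ) → Maybe (ofℚ a ≡ ofℚ b)
  ofℚ-≟ a b with a ℚ.≟ b
  ... | yes p = just (cong ofℚ p)
  ... | no _ = nothing

  module √-Solver = RingSolver ℚ.+-*-rawRing (ACR.fromCommutativeRing commutativeRing) ofℚ-morphism ofℚ-≟

  scale : ∀ c a b → ofℚ c ⊗ (a +√ b) ≡ ((c ℚ.* a) +√ (c ℚ.* b))
  scale c a b = cong₂ _+√_
    (solve 4 (λ c a b v → c :* a :+ v :* (con 0ℚ :* b) := c :* a) refl c a b v)
    (solve 3 (λ c a b → c :* b :+ con 0ℚ :* a := c :* b) refl c a b)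
    where open ℚ-Solver

  ofℕ-+ : ∀ m n → ofℕ (m ℕ.+ n) ≡ ofℕ m ⊕ ofℕ n
  ofℕ-+ m n = cong₂ _+√_ (cN-+ m n) refl

  ofℕ-* : ∀ m n → ofℕ (m ℕ.* n) ≡ ofℕ m ⊗ ofℕ n
  ofℕ-* m n = trans (cong₂ _+√_ (cN-* m n) (sym (ℚP.*-zeroʳ (cN m)))) (sym (scale (cN m) (cN n) 0ℚ))

  norm : Q√ → ℚ
  norm (a +√ b) = a ℚ.* a ℚ.- b ℚ.* b ℚ.* v

  norm-⊗ : ∀ x y → norm (x ⊗ y) ≡ norm x ℚ.* norm y
  norm-⊗ (a +√ b) (c +√ d) = solve 5 (λ a b c d v →
      (a :* c :+ v :* (b :* d)) :* (a :* c :+ v :* (b :* d)) :- (a :* d :+ b :* c) :* (a :* d :+ b :* c) :* v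
      := (a :* a :- b :* b :* v) :* (c :* c :- d :* d :* v)) refl a b c d v
    where open ℚ-Solver

  norm-pow : ∀ x m → norm (pow v x m) ≡ norm x ^ m
  norm-pow x zero = solve 1 (λ v → con 1ℚ :* con 1ℚ :- con 0ℚ :* con 0ℚ :* v := con 1ℚ) refl v
    where open ℚ-Solver
  norm-pow x (suc m) = trans (norm-⊗ (pow v x m) x) (cong (ℚ._* norm x) (norm-pow x m))

  ⊗-inv : ∀ x → norm x ≢ 0ℚ → x ⊗ inv v x ≡ 1√
  ⊗-inv (a +√ b) N≢0 = cong₂ _+√_
    (trans (solve 4 (λ a b v n → a :* (a :* n) :+ v :* (b :* (:- b :* n)) := (a :* a :- b :* b :* v) :* n)
             refl a b v n) (recip-inverse _ N≢0))
    (solve 3 (λ a b n → a :* (:- b :* n) :+ b :* (a :* n) := con 0ℚ) refl a b n)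
    where open ℚ-Solver
          n = recip (a ℚ.* a ℚ.- b ℚ.* b ℚ.* v)

  module Geometric (u : Q√) (invertible : (u ⊖ 1√) ⊗ inv v (u ⊖ 1√) ≡ 1√) where
    geom-zero : geom v u 0 ≡ 1√
    geom-zero = trans (cong (λ x → (x ⊖ 1√) ⊗ inv v (u ⊖ 1√)) (⊗-identityˡ u)) invertible

    geom-suc : ∀ k → geom v u (suc k) ≡ geom v u k ⊕ pow v u (suc k)
    geom-suc k = begin
      (p ⊗ u ⊖ 1√) ⊗ i                    ≡⟨ solve 3 (λ p u i → (p :* u :- con 1ℚ) :* i
                                                := (p :- con 1ℚ) :* i :+ p :* ((u :- con 1ℚ) :* i)) refl p u i ⟩
      geom v u k ⊕ p ⊗ ((u ⊖ 1√) ⊗ i)    ≡⟨ cong (λ x → geom v u k ⊕ p ⊗ x) invertible ⟩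
      geom v u k ⊕ p ⊗ 1√                ≡⟨ cong (geom v u k ⊕_) (⊗-identityʳ p) ⟩
      geom v u k ⊕ p                      ∎
      where open ≡-Reasoning
            open √-Solver
            p = pow v u (suc k)
            i = inv v (u ⊖ 1√)

  power-step : ∀ s z u α → u ⊗ u ≡ ofℚ s ⊗ u ⊕ ofℚ z → ∀ m →
    α ⊗ pow v u (suc (suc m)) ≡ ofℚ s ⊗ (α ⊗ pow v u (suc m)) ⊕ ofℚ z ⊗ (α ⊗ pow v u m)
  power-step s z u α root m = begin
    α ⊗ (p ⊗ u ⊗ u)                ≡⟨ solve 3 (λ a p u → a :* ((p :* u) :* u) := (a :* p) :* (u :* u)) refl α p u ⟩
    α ⊗ p ⊗ (u ⊗ u)                ≡⟨ cong (α ⊗ p ⊗_) root ⟩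
    α ⊗ p ⊗ (ofℚ s ⊗ u ⊕ ofℚ z)    ≡⟨ solve 5 (λ a p u s z → (a :* p) :* (s :* u :+ z)
                                        := s :* (a :* (p :* u)) :+ z :* (a :* p)) refl α p u (ofℚ s) (ofℚ z) ⟩
    ofℚ s ⊗ (α ⊗ (p ⊗ u)) ⊕ ofℚ z ⊗ (α ⊗ p) ∎
    where open ≡-Reasoning
          open √-Solver
          p = pow v u m

  binet-step : ∀ s z u w α β → u ⊗ u ≡ ofℚ s ⊗ u ⊕ ofℚ z → w ⊗ w ≡ ofℚ s ⊗ w ⊕ ofℚ z → ∀ m →
    α ⊗ pow v u (suc (suc m)) ⊕ β ⊗ pow v w (suc (suc m))
      ≡ ofℚ s ⊗ (α ⊗ pow v u (suc m) ⊕ β ⊗ pow v w (suc m)) ⊕ ofℚ z ⊗ (α ⊗ pow v u m ⊕ β ⊗ pow v w m)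
  binet-step s z u w α β u-root w-root m =
    trans (cong₂ _⊕_ (power-step s z u α u-root m) (power-step s z w β w-root m))
      (solve 6 (λ s z a b c d → (s :* a :+ z :* b) :+ (s :* c :+ z :* d) := s :* (a :+ c) :+ z :* (b :+ d))
        refl (ofℚ s) (ofℚ z) (α ⊗ pow v u (suc m)) (α ⊗ pow v u m) (β ⊗ pow v w (suc m)) (β ⊗ pow v w m))
    where open √-Solver

≡⇒Same : ∀ v {x y} → x ≡ y → Same v x y
≡⇒Same v {a +√ b} refl rewrite ℚP.+-inverseʳ a | ℚP.+-inverseʳ b = sym (ℚP.*-zeroˡ v) , ℚP.≤-refl

-- If  g + Λ/4 < Λa,  then  -½ < x < ½,  i.e. both
-- ½ + x and ½ - x are positive reals.  (For b < 0 positivity of ½ + x means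
-- (½+a)² > b²v, and (½+a)² - b²v = ¼ + a + N(x); symmetrically for ½ - x.)
withinHalf-byNorm : ∀ v Λ F g a b → 0ℚ ℚ.< Λ → Λ ℚ.* b ℚ.< 0ℚ →
  (Λ ℚ.* a) ℚ.* (Λ ℚ.* a) ℚ.- (Λ ℚ.* b) ℚ.* (Λ ℚ.* b) ℚ.* v ≡ Λ ℚ.* F →
  ℚ.- g ℚ.≤ F → F ℚ.≤ g → g ℚ.+ Λ ℚ.* ½ ℚ.* ½ ℚ.< Λ ℚ.* a →
  Pos v ((½ ℚ.+ a) +√ b) × Pos v ((½ ℚ.- a) +√ (ℚ.- b))
withinHalf-byNorm v Λ F g a b Λ>0 Λb<0 norm≡ -g≤F F≤g margin =
  inj₂ (inj₁ (½+a>0 , b<0 , pos-diff⇒< plus-norm))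
  , minus-pos
  where
  open ℚ-Solver
  Λ≥0 = ℚP.<⇒≤ Λ>0
  ½≥0 : 0ℚ ℚ.≤ ½
  ½≥0 = ℚP.nonNegative⁻¹ ½
  t = Λ ℚ.* a ℚ.- (g ℚ.+ Λ ℚ.* ½ ℚ.* ½)
  t>0 : 0ℚ ℚ.< t
  t>0 = <⇒pos-diff margin
  g+F≥0 : 0ℚ ℚ.≤ F ℚ.+ g
  g+F≥0 = nonneg-≡ (≤⇒nonneg-diff -g≤F) (solve 2 (λ f g → f :- :- g := f :+ g) refl F g)
  g-F≥0 : 0ℚ ℚ.≤ g ℚ.- F
  g-F≥0 = ≤⇒nonneg-diff F≤g
  g≥0 : 0ℚ ℚ.≤ g
  g≥0 = nonneg-≡ (nonneg-* ½≥0 (nonneg-+ g+F≥0 g-F≥0))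
          (solve 2 (λ f g → con ½ :* ((f :+ g) :+ (g :- f)) := g) refl F g)
  -b>0 : 0ℚ ℚ.< ℚ.- b
  -b>0 = pos-cancelˡ Λ>0 (pos-≡ (ℚP.neg-antimono-< Λb<0) (ℚP.neg-distribʳ-* Λ b))
  b<0 : b ℚ.< 0ℚ
  b<0 = subst (ℚ._< 0ℚ) (solve 1 (λ b → :- (:- b) := b) refl b) (ℚP.neg-antimono-< -b>0)
  ½+a>0 : 0ℚ ℚ.< ½ ℚ.+ a
  ½+a>0 = pos-cancelˡ Λ>0 (pos-≡ (pos-+ t>0 (nonneg-+ g≥0 (nonneg-+ (nonneg-* Λ≥0 ½≥0) (nonneg-* (nonneg-* Λ≥0 ½≥0) ½≥0))))
    (solve 3 (λ l a g → (l :* a :- (g :+ l :* con ½ :* con ½)) :+ (g :+ (l :* con ½ :+ l :* con ½ :* con ½))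
       := l :* (con ½ :+ a)) refl Λ a g))
  plus-norm : 0ℚ ℚ.< (½ ℚ.+ a) ℚ.* (½ ℚ.+ a) ℚ.- b ℚ.* b ℚ.* v
  plus-norm = pos-cancelˡ (pos-* Λ>0 Λ>0) (pos-≡ (pos-* Λ>0 (pos-+ t>0 (nonneg-+ g+F≥0 (nonneg-* Λ≥0 ½≥0)))) (begin
    Λ ℚ.* (t ℚ.+ ((F ℚ.+ g) ℚ.+ Λ ℚ.* ½))
      ≡⟨ solve 4 (λ l a g f → l :* ((l :* a :- (g :+ l :* con ½ :* con ½)) :+ ((f :+ g) :+ l :* con ½))
           := l :* l :* con ½ :* con ½ :+ l :* (l :* a) :+ l :* f) refl Λ a g F ⟩
    Λ ℚ.* Λ ℚ.* ½ ℚ.* ½ ℚ.+ Λ ℚ.* (Λ ℚ.* a) ℚ.+ Λ ℚ.* F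
      ≡⟨ cong (Λ ℚ.* Λ ℚ.* ½ ℚ.* ½ ℚ.+ Λ ℚ.* (Λ ℚ.* a) ℚ.+_) (sym norm≡) ⟩
    Λ ℚ.* Λ ℚ.* ½ ℚ.* ½ ℚ.+ Λ ℚ.* (Λ ℚ.* a) ℚ.+ ((Λ ℚ.* a) ℚ.* (Λ ℚ.* a) ℚ.- (Λ ℚ.* b) ℚ.* (Λ ℚ.* b) ℚ.* v)
      ≡⟨ solve 4 (λ l a b v → l :* l :* con ½ :* con ½ :+ l :* (l :* a) :+ ((l :* a) :* (l :* a) :- (l :* b) :* (l :* b) :* v)
           := l :* l :* ((con ½ :+ a) :* (con ½ :+ a) :- b :* b :* v)) refl Λ a b v ⟩
    Λ ℚ.* Λ ℚ.* ((½ ℚ.+ a) ℚ.* (½ ℚ.+ a) ℚ.- b ℚ.* b ℚ.* v) ∎))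
    where open ≡-Reasoning
  minus-norm : 0ℚ ℚ.< (ℚ.- b) ℚ.* (ℚ.- b) ℚ.* v ℚ.- (½ ℚ.- a) ℚ.* (½ ℚ.- a)
  minus-norm = pos-cancelˡ (pos-* Λ>0 Λ>0) (pos-≡ (pos-* Λ>0 (pos-+ t>0 g-F≥0)) (begin
    Λ ℚ.* (t ℚ.+ (g ℚ.- F))
      ≡⟨ solve 4 (λ l a g f → l :* ((l :* a :- (g :+ l :* con ½ :* con ½)) :+ (g :- f))
           := l :* (l :* a) :- l :* l :* con ½ :* con ½ :- l :* f) refl Λ a g F ⟩
    Λ ℚ.* (Λ ℚ.* a) ℚ.- Λ ℚ.* Λ ℚ.* ½ ℚ.* ½ ℚ.- Λ ℚ.* F
      ≡⟨ cong (λ n → Λ ℚ.* (Λ ℚ.* a) ℚ.- Λ ℚ.* Λ ℚ.* ½ ℚ.* ½ ℚ.- n) (sym norm≡) ⟩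
    Λ ℚ.* (Λ ℚ.* a) ℚ.- Λ ℚ.* Λ ℚ.* ½ ℚ.* ½ ℚ.- ((Λ ℚ.* a) ℚ.* (Λ ℚ.* a) ℚ.- (Λ ℚ.* b) ℚ.* (Λ ℚ.* b) ℚ.* v)
      ≡⟨ solve 4 (λ l a b v → l :* (l :* a) :- l :* l :* con ½ :* con ½ :- ((l :* a) :* (l :* a) :- (l :* b) :* (l :* b) :* v)
           := l :* l :* ((:- b) :* (:- b) :* v :- (con ½ :- a) :* (con ½ :- a))) refl Λ a b v ⟩
    Λ ℚ.* Λ ℚ.* ((ℚ.- b) ℚ.* (ℚ.- b) ℚ.* v ℚ.- (½ ℚ.- a) ℚ.* (½ ℚ.- a)) ∎))
    where open ≡-Reasoning
  minus-pos : Pos v ((½ ℚ.- a) +√ (ℚ.- b))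
  minus-pos with 0ℚ ℚ.≤? ½ ℚ.- a
  ... | yes ½-a≥0 = inj₁ (½-a≥0 , ℚP.<⇒≤ -b>0 , λ both → ℚP.<⇒≢ -b>0 (sym (proj₂ both)))
  ... | no ½-a≱0 = inj₂ (inj₂ (ℚP.≰⇒> ½-a≱0 , -b>0 , pos-diff⇒< minus-norm))

negative-recurrence : ∀ s z (y : ℕ → ℚ) → 0ℚ ℚ.< s → 0ℚ ℚ.≤ z →
  (∀ m → y (suc (suc m)) ≡ s ℚ.* y (suc m) ℚ.+ z ℚ.* y m) →
  y 0 ℚ.< 0ℚ → y 1 ℚ.< 0ℚ → ∀ m → y m ℚ.< 0ℚ
negative-recurrence s z y s>0 z≥0 rec y₀<0 y₁<0 m = proj₁ (pair m)
  where
  open ℚ-Solver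
  flip : ∀ {x} → 0ℚ ℚ.< ℚ.- x → x ℚ.< 0ℚ
  flip {x} h = subst (ℚ._< 0ℚ) (solve 1 (λ x → :- (:- x) := x) refl x) (ℚP.neg-antimono-< h)
  pair : ∀ m → y m ℚ.< 0ℚ × y (suc m) ℚ.< 0ℚ
  pair zero = y₀<0 , y₁<0
  pair (suc m) with pair m
  ... | yₘ<0 , yₘ₊₁<0 = yₘ₊₁<0 , flip (pos-≡
    (pos-+ (pos-* s>0 (ℚP.neg-antimono-< yₘ₊₁<0)) (nonneg-* z≥0 (ℚP.<⇒≤ (ℚP.neg-antimono-< yₘ<0))))
    (trans (solve 4 (λ s a z b → s :* (:- a) :+ z :* (:- b) := :- (s :* a :+ z :* b)) refl s (y (suc m)) z (y m))
           (cong ℚ.-_ (sym (rec m)))))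

linear-growth : ∀ s z (x : ℕ → ℚ) → 1ℚ ℚ.≤ s → 0ℚ ℚ.≤ z → 1ℚ ℚ.+ 1ℚ ℚ.≤ s ℚ.+ z →
  (∀ m → s ℚ.* x (suc m) ℚ.+ z ℚ.* x m ℚ.≤ x (suc (suc m))) →
  1ℚ ℚ.≤ x 0 → 1ℚ ℚ.≤ x 1 → ∀ m → cN m ℚ.≤ x m
linear-growth s z x s≥1 z≥0 s+z≥2 rec x₀≥1 x₁≥1 zero = ℚP.≤-trans (ℚP.nonNegative⁻¹ 1ℚ) x₀≥1
linear-growth s z x s≥1 z≥0 s+z≥2 rec x₀≥1 x₁≥1 (suc m) = proj₂ (invariant m)
  where
  open ℚ-Solver
  invariant : ∀ m → 1ℚ ℚ.≤ x m × cN (suc m) ℚ.≤ x (suc m)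
  invariant zero = x₀≥1 , x₁≥1
  invariant (suc m) with invariant m
  ... | xₘ≥1 , xₘ₊₁≥m+1 = xₘ₊₁≥1 , nonneg-diff⇒≤ (nonneg-≡
    (nonneg-+ (nonneg-+ (nonneg-+ (nonneg-+ (≤⇒nonneg-diff (rec m)) (≤⇒nonneg-diff xₘ₊₁≥m+1))
      (nonneg-* (≤⇒nonneg-diff s≥1) (≤⇒nonneg-diff xₘ₊₁≥1)))
      (nonneg-* z≥0 (≤⇒nonneg-diff xₘ≥1))) (≤⇒nonneg-diff s+z≥2))
    (trans (solve 6 (λ x₂ x₁ x₀ s z c →
        (x₂ :- (s :* x₁ :+ z :* x₀)) :+ (x₁ :- c) :+ (s :- con 1ℚ) :* (x₁ :- con 1ℚ) :+ z :* (x₀ :- con 1ℚ)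
          :+ (s :+ z :- (con 1ℚ :+ con 1ℚ))
        := x₂ :- (con 1ℚ :+ c)) refl (x (suc (suc m))) (x (suc m)) (x m) s z (cN (suc m)))
      (cong (λ c → x (suc (suc m)) ℚ.- c) (sym (cN-+ 1 (suc m))))))
    where xₘ₊₁≥1 = ℚP.≤-trans (cN-mono {1} {suc m} (ℕ.s≤s ℕ.z≤n)) xₘ₊₁≥m+1

root₁ root₂ : (v S : ℚ) → Q√
root₁ v S = mul v (ofℚ ½) (ofℚ S ⊖ rt)
root₂ v S = mul v (ofℚ ½) (ofℚ S ⊕ rt)

coef₁ coef₂ : (v W : ℚ) → Q√
coef₁ v W = div v (rt ⊖ ofℚ W) (mul v (ofℕ 2) rt)
coef₂ v W = div v (rt ⊕ ofℚ W) (mul v (ofℕ 2) rt)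

closedForm approxForm : (v S W : ℚ) → ℕ → Q√
closedForm v S W k = mul v (coef₁ v W) (geom v (root₁ v S) k) ⊕ mul v (coef₂ v W) (geom v (root₂ v S) k)
approxForm v S W k = mul v (coef₂ v W) (geom v (root₂ v S) k) ⊖ div v (coef₁ v W) (root₁ v S ⊖ ofℚ 1ℚ)

-- The algebra of the recurrence  Lₘ₊₂ = S Lₘ₊₁ + Z Lₘ  inside ℚ(√v), v = S² + 4Z,
-- assuming v > 0 and D = S + Z - 1 > 0 (so that 2√v and ω - 1 are invertible).
module Quadratic (S Z : ℚ) (v>0 : 0ℚ ℚ.< S ℚ.* S ℚ.+ cN 4 ℚ.* Z) (D>0 : 0ℚ ℚ.< S ℚ.+ Z ℚ.- 1ℚ) where

  v W D R Λ : ℚ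
  v = S ℚ.* S ℚ.+ cN 4 ℚ.* Z
  W = S ℚ.+ 1ℚ ℚ.+ 1ℚ
  D = S ℚ.+ Z ℚ.- 1ℚ
  R = S ℚ.+ 1ℚ ℚ.- Z
  Λ = v ℚ.* D

  open SqrtExt v

  ω₁ ω₂ κ₁ κ₂ : Q√
  ω₁ = root₁ v S
  ω₂ = root₂ v S
  κ₁ = coef₁ v W
  κ₂ = coef₂ v W

  ω₁≡ : ω₁ ≡ ((½ ℚ.* S) +√ (ℚ.- ½))
  ω₁≡ = cong₂ _+√_
    (solve 2 (λ s v → con ½ :* (s :+ :- con 0ℚ) :+ v :* (con 0ℚ :* (con 0ℚ :+ :- con 1ℚ)) := con ½ :* s) refl S v)
    (solve 1 (λ s → con ½ :* (con 0ℚ :+ :- con 1ℚ) :+ con 0ℚ :* (s :+ :- con 0ℚ) := :- con ½) refl S)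
    where open ℚ-Solver

  ω₂≡ : ω₂ ≡ ((½ ℚ.* S) +√ ½)
  ω₂≡ = cong₂ _+√_
    (solve 2 (λ s v → con ½ :* (s :+ con 0ℚ) :+ v :* (con 0ℚ :* (con 0ℚ :+ con 1ℚ)) := con ½ :* s) refl S v)
    (solve 1 (λ s → con ½ :* (con 0ℚ :+ con 1ℚ) :+ con 0ℚ :* (s :+ con 0ℚ) := con ½) refl S)
    where open ℚ-Solver

  half-root : ∀ h → h ℚ.* h ≡ ½ ℚ.* ½ →
    ((½ ℚ.* S) +√ h) ⊗ ((½ ℚ.* S) +√ h) ≡ ofℚ S ⊗ ((½ ℚ.* S) +√ h) ⊕ ofℚ Z
  half-root h h²≡¼ = cong₂ _+√_
    (begin
      (½ ℚ.* S) ℚ.* (½ ℚ.* S) ℚ.+ v ℚ.* (h ℚ.* h) ≡⟨ cong (λ t → (½ ℚ.* S) ℚ.* (½ ℚ.* S) ℚ.+ v ℚ.* t) h²≡¼ ⟩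
      (½ ℚ.* S) ℚ.* (½ ℚ.* S) ℚ.+ v ℚ.* (½ ℚ.* ½)
        ≡⟨ solve 3 (λ s z h → (con ½ :* s) :* (con ½ :* s) :+ (s :* s :+ con (cN 4) :* z) :* (con ½ :* con ½)
             := (s :* (con ½ :* s) :+ (s :* s :+ con (cN 4) :* z) :* (con 0ℚ :* h)) :+ z) refl S Z h ⟩
      (S ℚ.* (½ ℚ.* S) ℚ.+ v ℚ.* (0ℚ ℚ.* h)) ℚ.+ Z ∎)
    (solve 2 (λ s h → (con ½ :* s) :* h :+ h :* (con ½ :* s) := (s :* h :+ con 0ℚ :* (con ½ :* s)) :+ con 0ℚ) refl S h)
    where open ℚ-Solver
          open ≡-Reasoning

  ω₁-root : ω₁ ⊗ ω₁ ≡ ofℚ S ⊗ ω₁ ⊕ ofℚ Z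
  ω₁-root = subst (λ x → x ⊗ x ≡ ofℚ S ⊗ x ⊕ ofℚ Z) (sym ω₁≡) (half-root (ℚ.- ½) refl)

  ω₂-root : ω₂ ⊗ ω₂ ≡ ofℚ S ⊗ ω₂ ⊕ ofℚ Z
  ω₂-root = subst (λ x → x ⊗ x ≡ ofℚ S ⊗ x ⊕ ofℚ Z) (sym ω₂≡) (half-root ½ refl)

  norm-ω₁ : norm ω₁ ≡ ℚ.- Z
  norm-ω₁ = trans (cong norm ω₁≡)
    (solve 2 (λ s z → (con ½ :* s) :* (con ½ :* s) :- (:- con ½) :* (:- con ½) :* (s :* s :+ con (cN 4) :* z)
       := :- z) refl S Z)
    where open ℚ-Solver

  norm-ω₁-1 : norm (ω₁ ⊖ 1√) ≡ ℚ.- D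
  norm-ω₁-1 = trans (cong (λ x → norm (x ⊖ 1√)) ω₁≡)
    (solve 2 (λ s z → (con ½ :* s :+ :- con 1ℚ) :* (con ½ :* s :+ :- con 1ℚ)
         :- (:- con ½ :+ :- con 0ℚ) :* (:- con ½ :+ :- con 0ℚ) :* (s :* s :+ con (cN 4) :* z)
       := :- (s :+ z :- con 1ℚ)) refl S Z)
    where open ℚ-Solver

  norm-ω₂-1 : norm (ω₂ ⊖ 1√) ≡ ℚ.- D
  norm-ω₂-1 = trans (cong (λ x → norm (x ⊖ 1√)) ω₂≡)
    (solve 2 (λ s z → (con ½ :* s :+ :- con 1ℚ) :* (con ½ :* s :+ :- con 1ℚ)
         :- (con ½ :+ :- con 0ℚ) :* (con ½ :+ :- con 0ℚ) :* (s :* s :+ con (cN 4) :* z)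
       := :- (s :+ z :- con 1ℚ)) refl S Z)
    where open ℚ-Solver

  2√v : Q√
  2√v = ofℕ 2 ⊗ rt

  norm-2√v : norm 2√v ≡ ℚ.- (cN 4 ℚ.* v)
  norm-2√v = solve 1 (λ v → (con (cN 2) :* con 0ℚ :+ v :* (con 0ℚ :* con 1ℚ)) :* (con (cN 2) :* con 0ℚ :+ v :* (con 0ℚ :* con 1ℚ))
       :- (con (cN 2) :* con 1ℚ :+ con 0ℚ :* con 0ℚ) :* (con (cN 2) :* con 1ℚ :+ con 0ℚ :* con 0ℚ) :* v
       := :- (con (cN 4) :* v)) refl v
    where open ℚ-Solver

  invertible : ∀ x {n} → norm x ≡ ℚ.- n → 0ℚ ℚ.< n → x ⊗ inv v x ≡ 1√
  invertible x N≡ n>0 = ⊗-inv x (λ N≡0 → ℚP.<⇒≢ (ℚP.neg-antimono-< n>0) (trans (sym N≡) N≡0))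

  ω₁-1-inv : (ω₁ ⊖ 1√) ⊗ inv v (ω₁ ⊖ 1√) ≡ 1√
  ω₁-1-inv = invertible (ω₁ ⊖ 1√) norm-ω₁-1 D>0

  ω₂-1-inv : (ω₂ ⊖ 1√) ⊗ inv v (ω₂ ⊖ 1√) ≡ 1√
  ω₂-1-inv = invertible (ω₂ ⊖ 1√) norm-ω₂-1 D>0

  2√v-inv : 2√v ⊗ inv v 2√v ≡ 1√
  2√v-inv = invertible 2√v norm-2√v (pos-* (ℚP.positive⁻¹ (cN 4)) v>0)

  T : ℕ → Q√
  T m = κ₁ ⊗ pow v ω₁ m ⊕ κ₂ ⊗ pow v ω₂ m

  j : Q√
  j = inv v 2√v

  T-zero : T 0 ≡ 1√
  T-zero = trans (solve 3 (λ t w j → (t :- w) :* j :* con 1ℚ :+ (t :+ w) :* j :* con 1ℚ := con (cN 2) :* t :* j)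
                    refl rt (ofℚ W) j) 2√v-inv
    where open √-Solver

  T-one : T 1 ≡ ofℚ (S ℚ.+ 1ℚ)
  T-one = begin
    T 1
      ≡⟨ solve 3 (λ t s j → let w = s :+ con 1ℚ :+ con 1ℚ in
             (t :- w) :* j :* (con 1ℚ :* (con ½ :* (s :- t))) :+ (t :+ w) :* j :* (con 1ℚ :* (con ½ :* (s :+ t)))
           := con (cN 2) :* t :* j :* (s :+ con 1ℚ)) refl rt (ofℚ S) j ⟩
    2√v ⊗ j ⊗ (ofℚ S ⊕ 1√) ≡⟨ cong (_⊗ (ofℚ S ⊕ 1√)) 2√v-inv ⟩
    1√ ⊗ (ofℚ S ⊕ 1√)      ≡⟨ ⊗-identityˡ (ofℚ S ⊕ 1√) ⟩
    ofℚ (S ℚ.+ 1ℚ)         ∎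
    where open ≡-Reasoning
          open √-Solver

  T-step : ∀ m → T (suc (suc m)) ≡ ofℚ S ⊗ T (suc m) ⊕ ofℚ Z ⊗ T m
  T-step = binet-step S Z ω₁ ω₂ κ₁ κ₂ ω₁-root ω₂-root

  binet : (ℓ : ℕ → Q√) → ℓ 0 ≡ 1√ → ℓ 1 ≡ ofℚ (S ℚ.+ 1ℚ) →
    (∀ m → ℓ (suc (suc m)) ≡ ofℚ S ⊗ ℓ (suc m) ⊕ ofℚ Z ⊗ ℓ m) → ∀ m → T m ≡ ℓ m
  binet ℓ ℓ₀ ℓ₁ ℓ-step m = proj₁ (pair m)
    where
    pair : ∀ m → T m ≡ ℓ m × T (suc m) ≡ ℓ (suc m)
    pair zero = trans T-zero (sym ℓ₀) , trans T-one (sym ℓ₁)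
    pair (suc m) with pair m
    ... | Tₘ≡ , Tₘ₊₁≡ = Tₘ₊₁≡ , trans (T-step m)
          (trans (cong₂ (λ x y → ofℚ S ⊗ x ⊕ ofℚ Z ⊗ y) Tₘ₊₁≡ Tₘ≡) (sym (ℓ-step m)))

  C : ℕ → Q√
  C = closedForm v S W

  open Geometric ω₁ ω₁-1-inv renaming (geom-zero to g₁-zero; geom-suc to g₁-suc)
  open Geometric ω₂ ω₂-1-inv renaming (geom-zero to g₂-zero; geom-suc to g₂-suc)

  C-zero : C 0 ≡ T 0
  C-zero = cong₂ (λ x y → κ₁ ⊗ x ⊕ κ₂ ⊗ y) g₁-zero g₂-zero

  C-suc : ∀ k → C (suc k) ≡ C k ⊕ T (suc k)
  C-suc k = trans (cong₂ (λ x y → κ₁ ⊗ x ⊕ κ₂ ⊗ y) (g₁-suc k) (g₂-suc k))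
    (solve 6 (λ a b g h p q → a :* (g :+ p) :+ b :* (h :+ q) := (a :* g :+ b :* h) :+ (a :* p :+ b :* q))
      refl κ₁ κ₂ (geom v ω₁ k) (geom v ω₂ k) (pow v ω₁ (suc k)) (pow v ω₂ (suc k)))
    where open √-Solver

  partial-sums : (σ : ℕ → Q√) → σ 0 ≡ T 0 → (∀ k → σ (suc k) ≡ σ k ⊕ T (suc k)) → ∀ k → C k ≡ σ k
  partial-sums σ σ₀ σ-suc zero = trans C-zero (sym σ₀)
  partial-sums σ σ₀ σ-suc (suc k) =
    trans (C-suc k) (trans (cong (_⊕ T (suc k)) (partial-sums σ σ₀ σ-suc k)) (sym (σ-suc k)))

  c : Q√
  c = κ₁ ⊗ inv v (ω₁ ⊖ 1√)

  approx-error : ∀ k → approxForm v S W k ⊖ C k ≡ ⊝ (c ⊗ pow v ω₁ (suc k))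
  approx-error k = solve 5 (λ a b g i p → (b :* g :- a :* i) :- (a :* ((p :- con 1ℚ) :* i) :+ b :* g) := :- (a :* i :* p))
    refl κ₁ κ₂ (geom v ω₂ k) (inv v (ω₁ ⊖ 1√)) (pow v ω₁ (suc k))
    where open √-Solver

  -- Scaled by Λ = vD the constant c becomes  q₀ = v - (1+Z)√v.
  q₀ : Q√
  q₀ = v +√ (ℚ.- (1ℚ ℚ.+ Z))

  2√v[ω₁-1] : 2√v ⊗ (ω₁ ⊖ 1√) ≡ ((ℚ.- v) +√ (S ℚ.- 1ℚ ℚ.- 1ℚ))
  2√v[ω₁-1] = trans (cong (λ x → 2√v ⊗ (x ⊖ 1√)) ω₁≡) (cong₂ _+√_
    (solve 2 (λ s v → (con (cN 2) :* con 0ℚ :+ v :* (con 0ℚ :* con 1ℚ)) :* (con ½ :* s :+ :- con 1ℚ)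
         :+ v :* ((con (cN 2) :* con 1ℚ :+ con 0ℚ :* con 0ℚ) :* (:- con ½ :+ :- con 0ℚ)) := :- v) refl S v)
    (solve 2 (λ s v → (con (cN 2) :* con 0ℚ :+ v :* (con 0ℚ :* con 1ℚ)) :* (:- con ½ :+ :- con 0ℚ)
         :+ (con (cN 2) :* con 1ℚ :+ con 0ℚ :* con 0ℚ) :* (con ½ :* s :+ :- con 1ℚ) := s :- con 1ℚ :- con 1ℚ) refl S v))
    where open ℚ-Solver

  q₀-key : q₀ ⊗ (2√v ⊗ (ω₁ ⊖ 1√)) ≡ ofℚ Λ ⊗ (rt ⊖ ofℚ W)
  q₀-key = trans (cong (q₀ ⊗_) 2√v[ω₁-1]) (cong₂ _+√_
    (solve 2 (λ s z → let v = s :* s :+ con (cN 4) :* z in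
         v :* (:- v) :+ v :* ((:- (con 1ℚ :+ z)) :* (s :- con 1ℚ :- con 1ℚ))
       := v :* (s :+ z :- con 1ℚ) :* (con 0ℚ :+ :- (s :+ con 1ℚ :+ con 1ℚ)) :+ v :* (con 0ℚ :* (con 1ℚ :+ :- con 0ℚ))) refl S Z)
    (solve 2 (λ s z → let v = s :* s :+ con (cN 4) :* z in
         v :* (s :- con 1ℚ :- con 1ℚ) :+ (:- (con 1ℚ :+ z)) :* (:- v)
       := v :* (s :+ z :- con 1ℚ) :* (con 1ℚ :+ :- con 0ℚ) :+ con 0ℚ :* (con 0ℚ :+ :- (s :+ con 1ℚ :+ con 1ℚ))) refl S Z))
    where open ℚ-Solver

  Λc≡q₀ : ofℚ Λ ⊗ c ≡ q₀
  Λc≡q₀ = begin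
    ofℚ Λ ⊗ ((rt ⊖ ofℚ W) ⊗ j ⊗ i₁)
      ≡⟨ solve 4 (λ l x j i → l :* (x :* j :* i) := l :* x :* (j :* i)) refl (ofℚ Λ) (rt ⊖ ofℚ W) j i₁ ⟩
    ofℚ Λ ⊗ (rt ⊖ ofℚ W) ⊗ (j ⊗ i₁)              ≡⟨ cong (_⊗ (j ⊗ i₁)) (sym q₀-key) ⟩
    q₀ ⊗ (2√v ⊗ (ω₁ ⊖ 1√)) ⊗ (j ⊗ i₁)
      ≡⟨ solve 5 (λ q t d j i → q :* (t :* d) :* (j :* i) := q :* (t :* j :* (d :* i))) refl q₀ 2√v (ω₁ ⊖ 1√) j i₁ ⟩
    q₀ ⊗ (2√v ⊗ j ⊗ ((ω₁ ⊖ 1√) ⊗ i₁))           ≡⟨ cong₂ (λ x y → q₀ ⊗ (x ⊗ y)) 2√v-inv ω₁-1-inv ⟩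
    q₀ ⊗ (1√ ⊗ 1√)                              ≡⟨ solve 1 (λ q → q :* (con 1ℚ :* con 1ℚ) := q) refl q₀ ⟩
    q₀                                          ∎
    where open ≡-Reasoning
          open √-Solver
          i₁ = inv v (ω₁ ⊖ 1√)

  q : ℕ → Q√
  q m = q₀ ⊗ pow v ω₁ m

  scaled-error : ∀ m → ofℚ Λ ⊗ (c ⊗ pow v ω₁ m) ≡ q m
  scaled-error m = trans (solve 3 (λ l c p → l :* (c :* p) := l :* c :* p) refl (ofℚ Λ) c (pow v ω₁ m))
                         (cong (_⊗ pow v ω₁ m) Λc≡q₀)
    where open √-Solver

  q-step : ∀ m → q (suc (suc m)) ≡ ofℚ S ⊗ q (suc m) ⊕ ofℚ Z ⊗ q m
  q-step = power-step S Z ω₁ q₀ ω₁-root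

  norm-q₀ : norm q₀ ≡ Λ ℚ.* R
  norm-q₀ = solve 2 (λ s z → let v = s :* s :+ con (cN 4) :* z in
      v :* v :- (:- (con 1ℚ :+ z)) :* (:- (con 1ℚ :+ z)) :* v := v :* (s :+ z :- con 1ℚ) :* (s :+ con 1ℚ :- z)) refl S Z
    where open ℚ-Solver

  norm-q : ∀ m → norm (q m) ≡ Λ ℚ.* (R ℚ.* (ℚ.- Z) ^ m)
  norm-q m = begin
    norm (q₀ ⊗ pow v ω₁ m)            ≡⟨ norm-⊗ q₀ (pow v ω₁ m) ⟩
    norm q₀ ℚ.* norm (pow v ω₁ m)     ≡⟨ cong₂ ℚ._*_ norm-q₀ (trans (norm-pow ω₁ m) (cong (_^ m) norm-ω₁)) ⟩
    Λ ℚ.* R ℚ.* (ℚ.- Z) ^ m           ≡⟨ ℚP.*-assoc Λ R ((ℚ.- Z) ^ m) ⟩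
    Λ ℚ.* (R ℚ.* (ℚ.- Z) ^ m)         ∎
    where open ≡-Reasoning

  q-zero : q 0 ≡ q₀
  q-zero = ⊗-identityʳ q₀

  q-one : q 1 ≡ ((½ ℚ.* v ℚ.* (S ℚ.+ 1ℚ ℚ.+ Z)) +√ (ℚ.- (½ ℚ.* (v ℚ.+ (1ℚ ℚ.+ Z) ℚ.* S))))
  q-one = trans (cong (q₀ ⊗_) (trans (⊗-identityˡ ω₁) ω₁≡)) (cong₂ _+√_
    (solve 3 (λ v s z → v :* (con ½ :* s) :+ v :* ((:- (con 1ℚ :+ z)) :* (:- con ½))
       := con ½ :* v :* (s :+ con 1ℚ :+ z)) refl v S Z)
    (solve 3 (λ v s z → v :* (:- con ½) :+ (:- (con 1ℚ :+ z)) :* (con ½ :* s)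
       := :- (con ½ :* (v :+ (con 1ℚ :+ z) :* s))) refl v S Z))
    where open ℚ-Solver

±-bounded : ∀ {F g} → 0ℚ ℚ.≤ g → F ≡ g ⊎ F ≡ ℚ.- g → ℚ.- g ℚ.≤ F × F ℚ.≤ g
±-bounded {g = g} g≥0 (inj₁ refl) = ℚP.≤-trans (ℚP.neg-antimono-≤ g≥0) g≥0 , ℚP.≤-refl
±-bounded {g = g} g≥0 (inj₂ refl) = ℚP.≤-refl , ℚP.≤-trans (ℚP.neg-antimono-≤ g≥0) g≥0

-- The estimates, under the hypotheses  Z ≥ 0,  Z ≤ S  (i.e. r ≥ 1)  and  S + Z ≥ 2
-- (i.e. (z,r) ∉ {(0,1),(0,2)}).
module Estimates (S Z : ℚ) (Z≥0 : 0ℚ ℚ.≤ Z) (Z≤S : Z ℚ.≤ S) (2≤S+Z : 1ℚ ℚ.+ 1ℚ ℚ.≤ S ℚ.+ Z) where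
  open ℚ-Solver

  S-Z≥0 : 0ℚ ℚ.≤ S ℚ.- Z
  S-Z≥0 = ≤⇒nonneg-diff Z≤S

  S+Z-2≥0 : 0ℚ ℚ.≤ S ℚ.+ Z ℚ.- (1ℚ ℚ.+ 1ℚ)
  S+Z-2≥0 = ≤⇒nonneg-diff 2≤S+Z

  S-1≥0 : 0ℚ ℚ.≤ S ℚ.- 1ℚ
  S-1≥0 = nonneg-≡ (nonneg-* (ℚP.nonNegative⁻¹ ½) (nonneg-+ S-Z≥0 S+Z-2≥0))
    (solve 2 (λ s z → con ½ :* ((s :- z) :+ (s :+ z :- (con 1ℚ :+ con 1ℚ))) := s :- con 1ℚ) refl S Z)

  S>0 : 0ℚ ℚ.< S
  S>0 = pos-≡ (pos-+ (ℚP.positive⁻¹ 1ℚ) S-1≥0) (solve 1 (λ s → con 1ℚ :+ (s :- con 1ℚ) := s) refl S)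

  v>0 : 0ℚ ℚ.< S ℚ.* S ℚ.+ cN 4 ℚ.* Z
  v>0 = pos-+ (pos-* S>0 S>0) (nonneg-* (cN-nonneg 4) Z≥0)

  D-1≥0 : 0ℚ ℚ.≤ S ℚ.+ Z ℚ.- 1ℚ ℚ.- 1ℚ
  D-1≥0 = nonneg-≡ S+Z-2≥0 (solve 2 (λ s z → s :+ z :- (con 1ℚ :+ con 1ℚ) := s :+ z :- con 1ℚ :- con 1ℚ) refl S Z)

  D>0 : 0ℚ ℚ.< S ℚ.+ Z ℚ.- 1ℚ
  D>0 = pos-≡ (pos-+ (ℚP.positive⁻¹ 1ℚ) D-1≥0) (solve 2 (λ s z → con 1ℚ :+ (s :+ z :- con 1ℚ :- con 1ℚ) := s :+ z :- con 1ℚ) refl S Z)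

  open Quadratic S Z v>0 D>0 public
  open SqrtExt v

  R≥0 : 0ℚ ℚ.≤ R
  R≥0 = nonneg-≡ (nonneg-+ (ℚP.nonNegative⁻¹ 1ℚ) S-Z≥0) (solve 2 (λ s z → con 1ℚ :+ (s :- z) := s :+ con 1ℚ :- z) refl S Z)

  Λ>0 : 0ℚ ℚ.< Λ
  Λ>0 = pos-* v>0 D>0

  ρ σ : ℕ → ℚ
  ρ m = re (q m)
  σ m = im (q m)

  q-step′ : ∀ m → q (suc (suc m)) ≡ ((S ℚ.* ρ (suc m) ℚ.+ Z ℚ.* ρ m) +√ (S ℚ.* σ (suc m) ℚ.+ Z ℚ.* σ m))
  q-step′ m = trans (q-step m) (cong₂ _⊕_ (scale S (ρ (suc m)) (σ (suc m))) (scale Z (ρ m) (σ m)))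

  σ-negative : ∀ m → σ m ℚ.< 0ℚ
  σ-negative = negative-recurrence S Z σ S>0 Z≥0 (λ m → cong im (q-step′ m)) σ₀<0 σ₁<0
    where
    neg : ∀ {x} → 0ℚ ℚ.< x → ℚ.- x ℚ.< 0ℚ
    neg x>0 = ℚP.neg-antimono-< x>0
    σ₀<0 : σ 0 ℚ.< 0ℚ
    σ₀<0 = subst (ℚ._< 0ℚ) (sym (cong im q-zero)) (neg (pos-+ (ℚP.positive⁻¹ 1ℚ) Z≥0))
    σ₁<0 : σ 1 ℚ.< 0ℚ
    σ₁<0 = subst (ℚ._< 0ℚ) (sym (cong im q-one))
      (neg (pos-* (ℚP.positive⁻¹ ½) (pos-+ v>0 (nonneg-* (nonneg-+ (ℚP.nonNegative⁻¹ 1ℚ) Z≥0) (ℚP.<⇒≤ S>0)))))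

  -- Gₘ = ρₘ - R Zᵐ  (ρₘ minus the bound on the scaled norm) grows linearly.
  G : ℕ → ℚ
  G m = ρ m ℚ.- R ℚ.* Z ^ m

  G-forcing : ∀ m → S ℚ.* G (suc m) ℚ.+ Z ℚ.* G m ℚ.≤ G (suc (suc m))
  G-forcing m = nonneg-diff⇒≤ (nonneg-≡ (nonneg-* (nonneg-* R≥0 R≥0) (^-nonneg Z≥0 (suc m))) (begin
    R ℚ.* R ℚ.* (Z ^ m ℚ.* Z)
      ≡⟨ solve 5 (λ s z a b p → let r = s :+ con 1ℚ :- z in
           r :* r :* (p :* z) := ((s :* a :+ z :* b) :- r :* (p :* z :* z)) :- (s :* (a :- r :* (p :* z)) :+ z :* (b :- r :* p)))
           refl S Z (ρ (suc m)) (ρ m) (Z ^ m) ⟩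
    ((S ℚ.* ρ (suc m) ℚ.+ Z ℚ.* ρ m) ℚ.- R ℚ.* Z ^ suc (suc m)) ℚ.- (S ℚ.* G (suc m) ℚ.+ Z ℚ.* G m)
      ≡⟨ cong (λ x → (x ℚ.- R ℚ.* Z ^ suc (suc m)) ℚ.- (S ℚ.* G (suc m) ℚ.+ Z ℚ.* G m)) (sym (cong re (q-step′ m))) ⟩
    G (suc (suc m)) ℚ.- (S ℚ.* G (suc m) ℚ.+ Z ℚ.* G m) ∎))
    where open ≡-Reasoning

  G₀≥1 : 1ℚ ℚ.≤ G 0
  G₀≥1 = nonneg-diff⇒≤ (nonneg-≡
    (nonneg-+ (nonneg-* D-1≥0 R≥0) (nonneg-* Z≥0 (nonneg-+ Z≥0 (ℚP.nonNegative⁻¹ (1ℚ ℚ.+ 1ℚ)))))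
    (trans (solve 2 (λ s z → (s :+ z :- con 1ℚ :- con 1ℚ) :* (s :+ con 1ℚ :- z) :+ z :* (z :+ (con 1ℚ :+ con 1ℚ))
              := ((s :* s :+ con (cN 4) :* z) :- (s :+ con 1ℚ :- z) :* con 1ℚ) :- con 1ℚ) refl S Z)
           (cong (λ x → (x ℚ.- R ℚ.* 1ℚ) ℚ.- 1ℚ) (sym (cong re q-zero)))))

  G₁≥1 : 1ℚ ℚ.≤ G 1
  G₁≥1 = nonneg-diff⇒≤ (nonneg-≡
    (nonneg-* (ℚP.nonNegative⁻¹ ½) (nonneg-+ (nonneg-* (nonneg-+ (nonneg-* S+1≥0 S+1≥0) (ℚP.nonNegative⁻¹ 1ℚ)) (ℚP.<⇒≤ D>0))
                                                (nonneg-* (cN-nonneg 6) (nonneg-* Z≥0 Z≥0))))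
    (trans (solve 2 (λ s z → con ½ :* (((s :+ con 1ℚ) :* (s :+ con 1ℚ) :+ con 1ℚ) :* (s :+ z :- con 1ℚ) :+ con (cN 6) :* (z :* z))
              := (con ½ :* (s :* s :+ con (cN 4) :* z) :* (s :+ con 1ℚ :+ z) :- (s :+ con 1ℚ :- z) :* (con 1ℚ :* z)) :- con 1ℚ) refl S Z)
           (cong (λ x → (x ℚ.- R ℚ.* (1ℚ ℚ.* Z)) ℚ.- 1ℚ) (sym (cong re q-one)))))
    where S+1≥0 = nonneg-+ (ℚP.<⇒≤ S>0) (ℚP.nonNegative⁻¹ 1ℚ)

  G-growth : ∀ m → cN m ℚ.≤ G m
  G-growth = linear-growth S Z G (nonneg-diff⇒≤ S-1≥0) Z≥0 2≤S+Z G-forcing G₀≥1 G₁≥1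

  within-half : ∀ K → Λ ℚ.≤ cN K → ∀ k → K ℕ.≤ k → WithinHalf v (approxForm v S W k) (C k)
  within-half K Λ≤K k K≤k = subst (λ e → Pos v (ofℚ ½ ⊖ e) × Pos v (ofℚ ½ ⊕ e)) (sym (approx-error k))
    (subst₂ _×_ (cong (Pos v) plus≡) (cong (Pos v) minus≡)
      (withinHalf-byNorm v Λ F g a b Λ>0 (subst (ℚ._< 0ℚ) (sym Λb≡σ) (σ-negative m)) norm≡
        (proj₁ F-bounded) (proj₂ F-bounded) margin))
    where
    m = suc k
    p = c ⊗ pow v ω₁ m
    a = re p
    b = im p
    F g : ℚ
    F = R ℚ.* (ℚ.- Z) ^ m
    g = R ℚ.* Z ^ m
    Λp≡q : ((Λ ℚ.* a) +√ (Λ ℚ.* b)) ≡ q m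
    Λp≡q = trans (sym (scale Λ a b)) (scaled-error m)
    Λa≡ρ : Λ ℚ.* a ≡ ρ m
    Λa≡ρ = cong re Λp≡q
    Λb≡σ : Λ ℚ.* b ≡ σ m
    Λb≡σ = cong im Λp≡q
    norm≡ : (Λ ℚ.* a) ℚ.* (Λ ℚ.* a) ℚ.- (Λ ℚ.* b) ℚ.* (Λ ℚ.* b) ℚ.* v ≡ Λ ℚ.* F
    norm≡ = trans (cong norm Λp≡q) (norm-q m)
    F-bounded : ℚ.- g ℚ.≤ F × F ℚ.≤ g
    F-bounded = ±-bounded (nonneg-* R≥0 (^-nonneg Z≥0 m)) (case (neg-^ Z m))
      where
      case : (ℚ.- Z) ^ m ≡ Z ^ m ⊎ (ℚ.- Z) ^ m ≡ ℚ.- (Z ^ m) → F ≡ g ⊎ F ≡ ℚ.- g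
      case (inj₁ e) = inj₁ (cong (R ℚ.*_) e)
      case (inj₂ e) = inj₂ (trans (cong (R ℚ.*_) e) (sym (ℚP.neg-distribʳ-* R (Z ^ m))))
    Λ/4<G : Λ ℚ.* ½ ℚ.* ½ ℚ.< G m
    Λ/4<G = ℚP.≤-<-trans Λ/4≤Λ (ℚP.≤-<-trans Λ≤K (ℚP.≤-<-trans (cN-mono K≤k) (ℚP.<-≤-trans k<k+1 (G-growth m))))
      where
      Λ/4≤Λ : Λ ℚ.* ½ ℚ.* ½ ℚ.≤ Λ
      Λ/4≤Λ = nonneg-diff⇒≤ (nonneg-≡ (nonneg-* (ℚP.<⇒≤ Λ>0) (ℚP.nonNegative⁻¹ (½ ℚ.+ ½ ℚ.* ½)))
        (solve 1 (λ l → l :* (con ½ :+ con ½ :* con ½) := l :- l :* con ½ :* con ½) refl Λ))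
      k<k+1 : cN k ℚ.< cN m
      k<k+1 = pos-diff⇒< (pos-≡ (ℚP.positive⁻¹ 1ℚ)
        (trans (solve 1 (λ x → con 1ℚ := (con 1ℚ :+ x) :- x) refl (cN k)) (cong (ℚ._- cN k) (sym (cN-+ 1 k)))))
    margin : g ℚ.+ Λ ℚ.* ½ ℚ.* ½ ℚ.< Λ ℚ.* a
    margin = subst (g ℚ.+ Λ ℚ.* ½ ℚ.* ½ ℚ.<_)
      (trans (solve 2 (λ g r → g :+ (r :- g) := r) refl g (ρ m)) (sym Λa≡ρ))
      (ℚP.+-monoʳ-< g Λ/4<G)
    plus≡ : ((½ ℚ.+ a) +√ b) ≡ (ofℚ ½ ⊖ (⊝ p))
    plus≡ = cong₂ _+√_ (solve 2 (λ h a → h :+ a := h :+ :- (:- a)) refl ½ a)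
                       (solve 1 (λ b → b := con 0ℚ :+ :- (:- b)) refl b)
    minus≡ : ((½ ℚ.- a) +√ (ℚ.- b)) ≡ (ofℚ ½ ⊕ (⊝ p))
    minus≡ = cong₂ _+√_ refl (sym (ℚP.+-identityˡ (ℚ.- b)))

excluded-cases : ∀ z r → 1 ≤ r → ¬ (z ≡ 0 × r ≡ 1) → ¬ (z ≡ 0 × r ≡ 2) → 2 ≤ (z ℕ.+ r ℕ.∸ 1) ℕ.+ z
excluded-cases zero (suc zero) _ not01 _ = contradiction (refl , refl) not01
excluded-cases zero (suc (suc zero)) _ _ not02 = contradiction (refl , refl) not02
excluded-cases zero (suc (suc (suc c))) _ _ _ = ℕ.s≤s (ℕ.s≤s ℕ.z≤n)
excluded-cases (suc a) (suc b) _ _ _ = ℕP.+-mono-≤ (ℕP.≤-trans (ℕ.s≤s ℕ.z≤n) (ℕP.m≤n+m (suc b) a)) (ℕ.s≤s ℕ.z≤n)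

module Instance (z r : ℕ) (r≥1 : 1 ≤ r) (s+z≥2 : 2 ≤ (z ℕ.+ r ℕ.∸ 1) ℕ.+ z) where
  open ℚ-Solver

  s : ℕ
  s = z ℕ.+ r ℕ.∸ 1

  S Z : ℚ
  S = ι ((z ℕ.+ r) ℤ.⊖ 1)
  Z = cN z

  S≡s : S ≡ cN s
  S≡s = cong ι (ℤP.⊖-≥ (ℕP.≤-trans r≥1 (ℕP.m≤n+m r z)))

  S+1≡ : S ℚ.+ 1ℚ ≡ cN (z ℕ.+ r)
  S+1≡ = trans (cong (ℚ._+ 1ℚ) (ι-⊖ (z ℕ.+ r) 1)) (solve 1 (λ x → x :- con 1ℚ :+ con 1ℚ := x) refl (cN (z ℕ.+ r)))

  Z≤S : Z ℚ.≤ S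
  Z≤S = subst (Z ℚ.≤_) (sym S≡s) (cN-mono (subst (z ≤_) (sym (ℕP.+-∸-assoc z r≥1)) (ℕP.m≤m+n z (r ℕ.∸ 1))))

  2≤S+Z : 1ℚ ℚ.+ 1ℚ ℚ.≤ S ℚ.+ Z
  2≤S+Z = subst (1ℚ ℚ.+ 1ℚ ℚ.≤_) (trans (cN-+ s z) (cong (ℚ._+ Z) (sym S≡s))) (cN-mono s+z≥2)

  open Estimates S Z (cN-nonneg z) Z≤S 2≤S+Z
  open SqrtExt v

  v≡ : vv z r ≡ v
  v≡ = begin
    vv z r
      ≡⟨ ι-⊖ ((z ℕ.+ r) ℕ.* (z ℕ.+ r) ℕ.+ 2 ℕ.* z ℕ.+ 1) (2 ℕ.* r) ⟩
    cN ((z ℕ.+ r) ℕ.* (z ℕ.+ r) ℕ.+ 2 ℕ.* z ℕ.+ 1) ℚ.- cN (2 ℕ.* r)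
      ≡⟨ cong₂ ℚ._-_ (trans (cN-+ ((z ℕ.+ r) ℕ.* (z ℕ.+ r) ℕ.+ 2 ℕ.* z) 1)
                       (cong (ℚ._+ 1ℚ) (trans (cN-+ ((z ℕ.+ r) ℕ.* (z ℕ.+ r)) (2 ℕ.* z))
                         (cong₂ ℚ._+_ (cN-* (z ℕ.+ r) (z ℕ.+ r)) (cN-* 2 z)))))
                     (cN-* 2 r) ⟩
    (cN (z ℕ.+ r) ℚ.* cN (z ℕ.+ r) ℚ.+ cN 2 ℚ.* Z ℚ.+ 1ℚ) ℚ.- cN 2 ℚ.* cN r
      ≡⟨ cong (λ x → (x ℚ.* x ℚ.+ cN 2 ℚ.* Z ℚ.+ 1ℚ) ℚ.- cN 2 ℚ.* cN r) (trans (cN-+ z r) (sym (trans S+1≡ (cN-+ z r)))) ⟩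
    ((S ℚ.+ 1ℚ) ℚ.* (S ℚ.+ 1ℚ) ℚ.+ cN 2 ℚ.* Z ℚ.+ 1ℚ) ℚ.- cN 2 ℚ.* cN r
      ≡⟨ cong (λ x → ((S ℚ.+ 1ℚ) ℚ.* (S ℚ.+ 1ℚ) ℚ.+ cN 2 ℚ.* Z ℚ.+ 1ℚ) ℚ.- cN 2 ℚ.* x) r≡ ⟩
    ((S ℚ.+ 1ℚ) ℚ.* (S ℚ.+ 1ℚ) ℚ.+ cN 2 ℚ.* Z ℚ.+ 1ℚ) ℚ.- cN 2 ℚ.* (S ℚ.+ 1ℚ ℚ.- Z)
      ≡⟨ solve 2 (λ s z → ((s :+ con 1ℚ) :* (s :+ con 1ℚ) :+ con (cN 2) :* z :+ con 1ℚ) :- con (cN 2) :* (s :+ con 1ℚ :- z)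
           := s :* s :+ con (cN 4) :* z) refl S Z ⟩
    v ∎
    where
    open ≡-Reasoning
    r≡ : cN r ≡ S ℚ.+ 1ℚ ℚ.- Z
    r≡ = trans (solve 2 (λ a b → b := (a :+ b) :- a) refl Z (cN r)) (cong (ℚ._- Z) (sym (trans S+1≡ (cN-+ z r))))

  W≡ : cN (z ℕ.+ r ℕ.+ 1) ≡ W
  W≡ = trans (cN-+ (z ℕ.+ r) 1) (cong (ℚ._+ 1ℚ) (sym S+1≡))

  T≡L : ∀ m → T m ≡ ofℕ (L z r m)
  T≡L = binet (λ m → ofℕ (L z r m)) refl (cong ofℚ (sym S+1≡)) L-step
    where
    L-step : ∀ m → ofℕ (L z r (suc (suc m))) ≡ ofℚ S ⊗ ofℕ (L z r (suc m)) ⊕ ofℚ Z ⊗ ofℕ (L z r m)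
    L-step m = trans (ofℕ-+ (s ℕ.* L z r (suc m)) (z ℕ.* L z r m))
      (cong₂ _⊕_ (trans (ofℕ-* s (L z r (suc m))) (cong (λ x → ofℚ x ⊗ ofℕ (L z r (suc m))) (sym S≡s)))
                 (ofℕ-* z (L z r m)))

  C≡M : ∀ k → C k ≡ ofℕ (Msum z r k)
  C≡M = partial-sums (λ k → ofℕ (Msum z r k)) (sym (T≡L 0))
    (λ k → trans (ofℕ-+ (Msum z r k) (L z r (suc k))) (cong (ofℕ (Msum z r k) ⊕_) (sym (T≡L (suc k)))))

  -- A threshold:  K = (s² + 4z)(s + z)  satisfies  Λ = v(S + Z - 1) ≤ v(S + Z) = K.
  K : ℕ
  K = (s ℕ.* s ℕ.+ 4 ℕ.* z) ℕ.* (s ℕ.+ z)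

  Λ≤K : Λ ℚ.≤ cN K
  Λ≤K = nonneg-diff⇒≤ (nonneg-≡ (ℚP.<⇒≤ v>0) (begin
    v                                                   ≡⟨ solve 2 (λ s z → let v = s :* s :+ con (cN 4) :* z in
                                                             v := v :* (s :+ z) :- v :* (s :+ z :- con 1ℚ)) refl S Z ⟩
    v ℚ.* (S ℚ.+ Z) ℚ.- Λ                               ≡⟨ cong (λ x → (x ℚ.* x ℚ.+ cN 4 ℚ.* Z) ℚ.* (x ℚ.+ Z) ℚ.- Λ) S≡s ⟩
    (cN s ℚ.* cN s ℚ.+ cN 4 ℚ.* Z) ℚ.* (cN s ℚ.+ Z) ℚ.- Λ ≡⟨ cong (ℚ._- Λ) (sym K-cast) ⟩
    cN K ℚ.- Λ                                          ∎))
    where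
    open ≡-Reasoning
    K-cast : cN K ≡ (cN s ℚ.* cN s ℚ.+ cN 4 ℚ.* Z) ℚ.* (cN s ℚ.+ Z)
    K-cast = trans (cN-* (s ℕ.* s ℕ.+ 4 ℕ.* z) (s ℕ.+ z))
      (cong₂ ℚ._*_ (trans (cN-+ (s ℕ.* s) (4 ℕ.* z)) (cong₂ ℚ._+_ (cN-* s s) (cN-* 4 z))) (cN-+ s z))

  exact : ∀ k → Same (vv z r) (Mclosed z r k) (ofℕ (Msum z r k))
  exact k = subst₂ (λ w w′ → Same w (closedForm w S w′ k) (ofℕ (Msum z r k))) (sym v≡) (sym W≡)
    (≡⇒Same v (C≡M k))

  nearest : ∀ k → K ≤ k → WithinHalf (vv z r) (Xapprox z r k) (Mclosed z r k)
  nearest k K≤k = subst₂ (λ w w′ → WithinHalf w (approxForm w S w′ k) (closedForm w S w′ k)) (sym v≡) (sym W≡)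
    (within-half K Λ≤K k K≤k)

proposition4 : (z r : ℕ) → 1 ≤ r → ¬ (z ≡ 0 × r ≡ 1) → ¬ (z ≡ 0 × r ≡ 2) →
    ∃ λ K → (k : ℕ) → 1 ≤ k → K ≤ k →
      Same (vv z r) (Mclosed z r k) (ofℕ (Msum z r k))
        × WithinHalf (vv z r) (Xapprox z r k) (Mclosed z r k)
proposition4 z r r≥1 not01 not02 = K , λ k _ K≤k → exact k , nearest k K≤k
  where open Instance z r r≥1 (excluded-cases z r r≥1 not01 not02)
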